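{- Let $\sigma$ be a finite purely relational signature, $\mathfrak A$ a $\sigma$-structure with universe $A$ and $\mathcal M=(Q,B,\iota,\delta,F)$ an automaton with alphabet $B\subseteq A$. Then for all $u,v\in B^*$ with $\delta(\iota,u)=\delta(\iota,v)$, the mapping $f_{u,v}:uA^*\to vA^*$, $ux\mapsto vx$, is an isomorphism from $(\mathfrak A^*_u,L(\mathcal M))$ onto $(\mathfrak A^*_v,L(\mathcal M))$.
   Context: An automaton is a complete deterministic finite automaton $(Q,B,\iota,\delta,F)$ with finite alphabet $B$, $\delta$ extended to words, and language $L(\mathcal M)\subseteq B^*$. $\mathfrak A^*$ is the Shelah–Stupp iteration $(A^*,\preceq,(\hat R)_{R\in\sigma},\varepsilon)$ (finite words, prefix order, $\hat R=\{(wa_1,\dots,wa_n)\mid w\in A^*,(a_1,\dots,a_n)\in R^{\mathfrak A}\}$). For $u\in A^*$, $\mathfrak A^*_u=(uA^*,\sqsubseteq,(\bar R)_{R\in\sigma},u)$ where $\sqsubseteq$ is the restriction of $\preceq$ to $uA^*$, $\bar R$ is the restriction of $\hat R$ to $uA^+$ (nonempty extensions of $u$), and $u$ is a constant. $(\mathfrak A^*_u,L)$ denotes $\mathfrak A^*_u$ expanded by the unary predicate $L\cap uA^*$. -}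

module Defs where

open import Data.Nat using (ℕ)
open import Data.Fin using (Fin)
open import Data.Bool using (Bool; true)
open import Data.List using (List; []; _∷_; _++_)
open import Data.Vec using (Vec)
import Data.Vec as Vec
open import Data.Product using (Σ; ∃; ∃-syntax; _×_; _,_; proj₁)
open import Data.List.Properties using (++-identityʳ)
open import Relation.Binary.PropositionalEquality using (_≡_; refl)
open import Function.Bundles using (_⇔_)
open import Function.Definitions using (Injective)

record Signature : Set where
  field
    nSym  : ℕ
    arity : Fin nSym → ℕ
open Signature public

record Structure (σ : Signature) : Set₁ where
  field
    A   : Set
    rel : (i : Fin (nSym σ)) → Vec A (arity σ i) → Set
open Structure public

-- Complete DFA (Q,B,ι,δ,F) with finite Q = Fin nQ, finite alphabet B = Fin nB,
-- and an injective embedding B ↪ A (alphabet B ⊆ A).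
record Automaton (A : Set) : Set where
  field
    nQ  : ℕ
    nB  : ℕ
    emb : Fin nB → A
    emb-injective : Injective _≡_ _≡_ emb
    ι   : Fin nQ
    δ   : Fin nQ → Fin nB → Fin nQ
    F   : Fin nQ → Bool
open Automaton public

module _ {A : Set} (M : Automaton A) where
  δ* : Fin (nQ M) → List (Fin (nB M)) → Fin (nQ M)
  δ* q []       = q
  δ* q (b ∷ bs) = δ* (δ M q b) bs

  embW : List (Fin (nB M)) → List A
  embW []       = []
  embW (b ∷ bs) = emb M b ∷ embW bs

  InL : List A → Set
  InL w = Σ (List (Fin (nB M))) λ bs → (embW bs ≡ w) × (F M (δ* (ι M) bs) ≡ true)

module _ {A : Set} where
  _≼_ : List A → List A → Set
  u ≼ w = ∃[ z ] (u ++ z ≡ w)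

  StrictExt : List A → List A → Set
  StrictExt u w = ∃[ a ] ∃[ z ] (u ++ (a ∷ z) ≡ w)

  U : List A → Set
  U u = Σ (List A) (λ w → u ≼ w)

  word : {u : List A} → U u → List A
  word = proj₁

  const : (u : List A) → U u
  const u = u , [] , ++-identityʳ u

module _ {σ : Signature} (𝔄 : Structure σ) where
  private
    A' = A 𝔄

  Rhat : (i : Fin (nSym σ)) → Vec (List A') (arity σ i) → Set
  Rhat i ws = ∃[ w ] ∃[ as ] (rel 𝔄 i as × ws ≡ Vec.map (λ a → w ++ (a ∷ [])) as)

  Rbar : (u : List A') (i : Fin (nSym σ)) → Vec (U u) (arity σ i) → Set
  Rbar u i xs = Rhat i (Vec.map word xs) × (∀ k → StrictExt u (word (Vec.lookup xs k)))

  _⊑_ : {u : List A'} → U u → U u → Set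
  x ⊑ y = word x ≼ word y

  fmap : (u v : List A') → U u → U v
  fmap u v (w , x , _) = v ++ x , x , refl

  -- f is an isomorphism (𝔄*_u, L) ≅ (𝔄*_v, L); elements compared via their words.
  record IsIsoL (M : Automaton A') (u v : List A') (f : U u → U v) : Set where
    field
      injective  : ∀ x y → word (f x) ≡ word (f y) → word x ≡ word y
      surjective : ∀ (y : U v) → ∃[ x ] (word (f x) ≡ word y)
      pres-≼     : ∀ x y → (x ⊑ y) ⇔ (f x ⊑ f y)
      pres-rel   : ∀ i (xs : Vec (U u) (arity σ i)) → Rbar u i xs ⇔ Rbar v i (Vec.map f xs)
      pres-const : word (f (const u)) ≡ v
      pres-L     : ∀ x → InL M (word x) ⇔ InL M (word (f x))

module Submission where

-- Write every element of 𝔄*_u as u ++ s; then f_{u,v} replaces the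
-- root u by v and keeps the suffix s.  Each component of the isomorphism is an
-- instance of one "re-rooting" principle: a property of words u ++ s that only
-- depends on the suffixes s transfers from root u to root v.
--   * Prefix order and proper extensions: u ++ s ≼ u ++ s' iff s ≼ s', by left
--     cancellation of _++_.
--   * Relations R̂: a tuple in R̂ consists of children w ++ [a] of a common parent
--     w.  If the tuple lies in uA⁺ and is nonempty, then the parent w extends u,
--     say w = u ++ t, so re-rooting the tuple gives the children of v ++ t.
--     Elements of R̄ are first normalised to suffix vectors (RelAt).
--   * The language: a word of B* whose image is embW u ++ x is u ++ cs with
--     embW cs = x, and δ(ι, u ++ cs) = δ(δ(ι,u), cs) = δ(δ(ι,v), cs) = δ(ι, v ++ cs).

open import Defs
open import Data.List using (List; []; _∷_; _++_; [_])
open import Data.List.Properties using (++-cancelˡ; ++-conicalʳ; ++-assoc; ++-identityʳ; ∷-injectiveˡ; ∷-injectiveʳ)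
open import Data.Fin using (Fin)
open import Data.Vec using (Vec) renaming ([] to []ᵥ; _∷_ to _∷ᵥ_)
import Data.Vec as Vec
open import Data.Vec.Properties using (map-∘; map-cong; lookup-map)
import Data.Vec.Properties as Vecₚ
open import Data.Product using (∃-syntax; _×_; _,_; proj₁; proj₂)
open import Function.Bundles using (_⇔_; mk⇔; Equivalence)
open import Relation.Binary.PropositionalEquality
  using (_≡_; refl; sym; trans; cong; cong₂; subst; module ≡-Reasoning)

module Words {A : Set} where

  snoc : List A → A → List A
  snoc w a = w ++ [ a ]

  ≼-reroot : ∀ (u v s s' : List A) → (u ++ s) ≼ (u ++ s') → (v ++ s) ≼ (v ++ s')
  ≼-reroot u v s s' (z , us++z≡us') = z , (begin
      (v ++ s) ++ z  ≡⟨ ++-assoc v s z ⟩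
      v ++ (s ++ z)  ≡⟨ cong (v ++_) (++-cancelˡ u _ _ (trans (sym (++-assoc u s z)) us++z≡us')) ⟩
      v ++ s'        ∎)
    where open ≡-Reasoning

  -- u ++ s is a proper extension of u exactly when s is nonempty, whatever u is.
  strictExt-reroot : ∀ (u v s : List A) → StrictExt u (u ++ s) → StrictExt v (v ++ s)
  strictExt-reroot u v s (a , z , u++az≡u++s) = a , z , cong (v ++_) (++-cancelˡ u _ _ u++az≡u++s)

  strictExt-parent : ∀ (u w : List A) {a} → StrictExt u (snoc w a) → u ≼ w
  strictExt-parent []      w       _                  = w , refl
  strictExt-parent (c ∷ u) []      (b , z , eq) with ++-conicalʳ u (b ∷ z) (∷-injectiveʳ eq)
  ... | ()
  strictExt-parent (c ∷ u) (d ∷ w) (b , z , eq) with strictExt-parent u w (b , z , ∷-injectiveʳ eq)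
  ... | t , u++t≡w = t , cong₂ _∷_ (∷-injectiveˡ eq) u++t≡w

  children-reroot : ∀ {n} (u v t : List A) (ss : Vec (List A) n) (as : Vec A n)
    → Vec.map (u ++_) ss ≡ Vec.map (snoc (u ++ t)) as
    → Vec.map (v ++_) ss ≡ Vec.map (snoc (v ++ t)) as
  children-reroot u v t []ᵥ       []ᵥ       _  = refl
  children-reroot u v t (s ∷ᵥ ss) (a ∷ᵥ as) eq =
    cong₂ _∷ᵥ_ child (children-reroot u v t ss as (Vecₚ.∷-injectiveʳ eq))
    where
    open ≡-Reasoning
    s≡snoc : s ≡ t ++ [ a ]
    s≡snoc = ++-cancelˡ u _ _ (trans (Vecₚ.∷-injectiveˡ eq) (++-assoc u t [ a ]))
    child : v ++ s ≡ snoc (v ++ t) a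
    child = begin
      v ++ s            ≡⟨ cong (v ++_) s≡snoc ⟩
      v ++ (t ++ [ a ]) ≡⟨ sym (++-assoc v t [ a ]) ⟩
      snoc (v ++ t) a   ∎

  siblings-reroot : ∀ {n} (u v w : List A) (ss : Vec (List A) n) (as : Vec A n)
    → (∀ k → StrictExt u (u ++ Vec.lookup ss k))
    → Vec.map (u ++_) ss ≡ Vec.map (snoc w) as
    → ∃[ w' ] (Vec.map (v ++_) ss ≡ Vec.map (snoc w') as)
  siblings-reroot u v w []ᵥ       []ᵥ       _      _  = w , refl
  siblings-reroot u v w (s ∷ᵥ ss) (a ∷ᵥ as) proper eq
    with strictExt-parent u w (subst (StrictExt u) (Vecₚ.∷-injectiveˡ eq) (proper Fin.zero))
  ... | t , refl = v ++ t , children-reroot u v t (s ∷ᵥ ss) (a ∷ᵥ as) eq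

open Words

module Relations {σ : Signature} (𝔄 : Structure σ) where

  private
    A' = A 𝔄

  suffix : {u : List A'} → U u → List A'
  suffix x = proj₁ (proj₂ x)

  RelAt : (u : List A') (i : Fin (nSym σ)) → Vec (List A') (arity σ i) → Set
  RelAt u i ss = Rhat 𝔄 i (Vec.map (u ++_) ss) × (∀ k → StrictExt u (u ++ Vec.lookup ss k))

  Rbar⇔RelAt : ∀ (w : List A') i (ys : Vec (U w) (arity σ i)) (ss : Vec (List A') (arity σ i))
    → Vec.map word ys ≡ Vec.map (w ++_) ss → Rbar 𝔄 w i ys ⇔ RelAt w i ss
  Rbar⇔RelAt w i ys ss words≡ = mk⇔
    (λ (r , proper) → subst (Rhat 𝔄 i) words≡ r , λ k → subst (StrictExt w) (word-at k) (proper k))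
    (λ (r , proper) → subst (Rhat 𝔄 i) (sym words≡) r , λ k → subst (StrictExt w) (sym (word-at k)) (proper k))
    where
    open ≡-Reasoning
    word-at : ∀ k → word (Vec.lookup ys k) ≡ w ++ Vec.lookup ss k
    word-at k = begin
      word (Vec.lookup ys k)             ≡⟨ sym (lookup-map k word ys) ⟩
      Vec.lookup (Vec.map word ys) k     ≡⟨ cong (λ zs → Vec.lookup zs k) words≡ ⟩
      Vec.lookup (Vec.map (w ++_) ss) k  ≡⟨ lookup-map k (w ++_) ss ⟩
      w ++ Vec.lookup ss k               ∎

  words-at-root : ∀ {n} (u : List A') (xs : Vec (U u) n)
    → Vec.map word xs ≡ Vec.map (u ++_) (Vec.map suffix xs)
  words-at-root u xs = begin
    Vec.map word xs                  ≡⟨ map-cong (λ x → sym (proj₂ (proj₂ x))) xs ⟩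
    Vec.map (λ x → u ++ suffix x) xs ≡⟨ map-∘ (u ++_) suffix xs ⟩
    Vec.map (u ++_) (Vec.map suffix xs) ∎
    where open ≡-Reasoning

  words-after-fmap : ∀ {n} (u v : List A') (xs : Vec (U u) n)
    → Vec.map word (Vec.map (fmap 𝔄 u v) xs) ≡ Vec.map (v ++_) (Vec.map suffix xs)
  words-after-fmap u v xs = begin
    Vec.map word (Vec.map (fmap 𝔄 u v) xs) ≡⟨ sym (map-∘ word (fmap 𝔄 u v) xs) ⟩
    Vec.map (λ x → v ++ suffix x) xs      ≡⟨ map-∘ (v ++_) suffix xs ⟩
    Vec.map (v ++_) (Vec.map suffix xs)   ∎
    where open ≡-Reasoning

  RelAt-reroot : ∀ (u v : List A') i (ss : Vec (List A') (arity σ i)) → RelAt u i ss → RelAt v i ss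
  RelAt-reroot u v i ss ((w , as , r , eq) , proper) with siblings-reroot u v w ss as proper eq
  ... | w' , eq' = (w' , as , r , eq') , λ k → strictExt-reroot u v _ (proper k)

  fmap-pres-rel : ∀ (u v : List A') i (xs : Vec (U u) (arity σ i))
    → Rbar 𝔄 u i xs ⇔ Rbar 𝔄 v i (Vec.map (fmap 𝔄 u v) xs)
  fmap-pres-rel u v i xs = mk⇔
    (λ r → from-v (RelAt-reroot u v i ss (to-u r)))
    (λ r → from-u (RelAt-reroot v u i ss (to-v r)))
    where
    ss = Vec.map suffix xs
    open Equivalence (Rbar⇔RelAt u i xs ss (words-at-root u xs)) renaming (to to to-u; from to from-u)
    open Equivalence (Rbar⇔RelAt v i (Vec.map (fmap 𝔄 u v) xs) ss (words-after-fmap u v xs))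
      renaming (to to to-v; from to from-v)

open Relations using (fmap-pres-rel)

module Language {A : Set} (M : Automaton A) where

  embW-++ : ∀ bs cs → embW M (bs ++ cs) ≡ embW M bs ++ embW M cs
  embW-++ []       cs = refl
  embW-++ (b ∷ bs) cs = cong (emb M b ∷_) (embW-++ bs cs)

  δ*-++ : ∀ q bs cs → δ* M q (bs ++ cs) ≡ δ* M (δ* M q bs) cs
  δ*-++ q []       cs = refl
  δ*-++ q (b ∷ bs) cs = δ*-++ (δ M q b) bs cs

  -- Since B ↪ A is injective, a word of B* whose image starts with embW u is u ++ cs.
  embW-split : ∀ u bs x → embW M bs ≡ embW M u ++ x → ∃[ cs ] ((bs ≡ u ++ cs) × (embW M cs ≡ x))
  embW-split []      bs       x eq = bs , refl , eq
  embW-split (c ∷ u) []       x ()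
  embW-split (c ∷ u) (b ∷ bs) x eq with embW-split u bs x (∷-injectiveʳ eq)
  ... | cs , bs≡u++cs , embcs≡x = cs , cong₂ _∷_ (emb-injective M (∷-injectiveˡ eq)) bs≡u++cs , embcs≡x

  InL-reroot : ∀ u v x → δ* M (ι M) u ≡ δ* M (ι M) v → InL M (embW M u ++ x) → InL M (embW M v ++ x)
  InL-reroot u v x same-state (bs , embbs≡ , accept) with embW-split u bs x embbs≡
  ... | cs , refl , embcs≡x = v ++ cs , trans (embW-++ v cs) (cong (embW M v ++_) embcs≡x) ,
                              trans (cong (F M) same-run) accept
    where
    open ≡-Reasoning
    same-run : δ* M (ι M) (v ++ cs) ≡ δ* M (ι M) (u ++ cs)
    same-run = begin
      δ* M (ι M) (v ++ cs)       ≡⟨ δ*-++ (ι M) v cs ⟩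
      δ* M (δ* M (ι M) v) cs     ≡⟨ cong (λ q → δ* M q cs) (sym same-state) ⟩
      δ* M (δ* M (ι M) u) cs     ≡⟨ sym (δ*-++ (ι M) u cs) ⟩
      δ* M (ι M) (u ++ cs)       ∎

open Language using (InL-reroot)

lemma3p4 : (σ : Signature) (𝔄 : Structure σ) (M : Automaton (A 𝔄))
    → (u v : List (Fin (nB M)) ) → δ* M (ι M) u ≡ δ* M (ι M) v
    → IsIsoL 𝔄 M (embW M u) (embW M v) (fmap 𝔄 (embW M u) (embW M v))
lemma3p4 σ 𝔄 M u v same-state = record
  { injective  = λ { (_ , s , refl) (_ , s' , refl) eq → cong (u' ++_) (++-cancelˡ v' s s' eq) }
  ; surjective = λ { (w , s , v's≡w) → (u' ++ s , s , refl) , v's≡w }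
  ; pres-≼     = λ { (_ , s , refl) (_ , s' , refl) → mk⇔ (≼-reroot u' v' s s') (≼-reroot v' u' s s') }
  ; pres-rel   = fmap-pres-rel 𝔄 u' v'
  ; pres-const = ++-identityʳ v'
  ; pres-L     = λ { (_ , s , refl) → mk⇔ (InL-reroot M u v s same-state) (InL-reroot M v u s (sym same-state)) }
  }
  where
  u' = embW M u
  v' = embW M v
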